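{- Let $p$ be an odd prime and let $\{x_1,\ldots,x_n\}\subset \mathbb{F}_p^2\setminus\{(0,0)\}$ be a set of vectors spanning all $p+1$ nonzero directions from $0$ in $\mathbb{F}_p^2$, i.e. for every line $\ell$ through the origin in $\mathbb{F}_p^2$ (every set $\{(x,y): ax+by=0\}$ with $(a,b)\neq(0,0)$) some $x_i$ lies on $\ell$. Then there exists a nonempty subset $I\subset\{1,\ldots,n\}$ such that $\sum_{i\in I} x_i = 0$.
   Context: Two vectors $(a,b),(c,d)\in\mathbb{F}_p^2$ have the same direction from zero if $(a,b)=(tc,td)$ for some $t\in\mathbb{F}_p\setminus\{0\}$; there are exactly $p+1$ nonzero directions. -}

module Defs where

open import Data.Nat using (ℕ; zero; suc; _+_; _*_; NonZero)
open import Data.Nat.DivMod using (_mod_; _%_)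
open import Data.Fin using (Fin; toℕ)
open import Data.Product using (_×_; _,_; proj₁; proj₂)
open import Data.Bool using (Bool; true; false)
open import Data.Vec using (Vec; lookup)
open import Relation.Binary.PropositionalEquality using (_≡_)
open import Relation.Nullary using (¬_)

module _ (p : ℕ) .{{_ : NonZero p}} where

  F : Set
  F = Fin p

  infixl 6 _+F_
  infixl 7 _*F_

  _+F_ : F → F → F
  a +F b = (toℕ a + toℕ b) mod p

  _*F_ : F → F → F
  a *F b = (toℕ a * toℕ b) mod p

  0F : F
  0F = 0 mod p

  V : Set
  V = F × F

  0V : V
  0V = 0F , 0F

  _+V_ : V → V → V
  (a , b) +V (c , d) = (a +F c) , (b +F d)

  OnLine : V → V → Set
  OnLine (a , b) v = (a *F proj₁ v) +F (b *F proj₂ v) ≡ 0F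

  SpansAllDirections : {n : ℕ} → (Fin n → V) → Set
  SpansAllDirections {n} x =
    (ab : V) → ¬ ab ≡ 0V → Data.Product.Σ (Fin n) λ i → OnLine ab (x i)

  subsetSum : {n : ℕ} → (Fin n → V) → Vec Bool n → V
  subsetSum {zero} x I = 0V
  subsetSum {suc n} x (b Data.Vec.∷ I) =
    add b (subsetSum {n} (λ i → x (Fin.suc i)) I)
    where
    add : Bool → V → V
    add true s = x Fin.zero +V s
    add false s = s

module Submission where

-- Suppose no nonempty subset of the x i sums to zero, and count modulo 2 the pairs (I, ℓ) of a
-- subset I ⊆ {1,…,n} and a line ℓ through the origin containing ∑_{i∈I} x i.  For a fixed
-- line ℓ, pick x i on ℓ: toggling i in I does not change whether the sum lies on ℓ, so the
-- subsets pair up and the count for ℓ is even.  For a fixed I ≠ ∅ the sum is a nonzero vector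
-- and lies on exactly one line, while for I = ∅ the sum 0 lies on all p + 1 lines, an even
-- number since p is odd.  Hence the total is 2ⁿ − 1 ≡ 1, a contradiction.  As there are finitely
-- many subsets, this contradiction yields an explicit zero-sum subset.

open import Defs
open import Data.Nat using (ℕ; zero; suc; pred; _+_; _*_; _<_; _≤_; NonZero; >-nonZero⁻¹;
  nonTrivial⇒n>1; parity)
open import Data.Nat.Properties using (*-assoc; *-zeroʳ; *-identityˡ; +-identityʳ; ≤-total; ≤-<-trans;
  m≤n+m; <⇒≱; suc-pred; m≤n⇒∃[o]m+o≡n)
open import Data.Nat.DivMod using (_mod_; _%_; m%n<n; %-distribˡ-+; %-distribˡ-*; m%n%n≡m%n;
  m<n⇒m%n≡m)
open import Data.Nat.Divisibility using (_∣_; _∣?_; divides; _∣0; ∣⇒≤; ∣m+n∣m⇒∣n; ∣n⇒∣m*n;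
  m%n≡0⇒n∣m; n∣m⇒m%n≡0)
open import Data.Nat.Primality using (Prime; prime⇒nonZero; prime⇒nonTrivial; prime⇒irreducible;
  euclidsLemma)
open import Data.Nat.Coprimality using (Coprime; coprime-Bézout)
open import Data.Nat.GCD using (module Bézout)
open import Data.Nat.Tactic.RingSolver using (solve-∀)
open import Data.Parity.Base as ℙ using (Parity; 0ℙ; 1ℙ; _⁻¹)
open import Data.Parity.Properties using (p+p≡0ℙ; +-0-commutativeMonoid; suc-homo-⁻¹;
  ⁻¹-selfInverse)
open import Algebra.Properties.CommutativeMonoid.Sum +-0-commutativeMonoid
  using (sum-syntax; ∑-distrib-+; sum-cong-≗; sum-remove; sum-replicate-zero)
open import Data.Bool using (not)
open import Data.Fin using (Fin; zero; suc; toℕ; fromℕ<; punchIn; _≟_)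
open import Data.Fin.Properties using (toℕ-fromℕ<; toℕ-injective; toℕ<n; punchInᵢ≢i)
open import Data.Fin.Subset using (Subset; Nonempty; ⊥; inside; outside)
open import Data.Fin.Subset.Properties using (nonempty?; anySubset?)
open import Data.Vec using (_∷_; []; _[_]%=_; here; there)
open import Data.Product using (Σ; ∃-syntax; _×_; _,_; proj₁; proj₂)
open import Data.Product.Properties using (≡-dec)
open import Data.Sum using (inj₁; inj₂)
open import Function.Bundles using (_⇔_; mk⇔; Equivalence)
open import Function.Definitions using (Injective)
open import Relation.Binary.PropositionalEquality
open import Relation.Nullary using (¬_; Dec; yes; no; contradiction; _×-dec_)

module _ {d : ℕ} .{{_ : NonZero d}} where

  [m*[n%d]]%d≡[m*n]%d : ∀ m n → (m * (n % d)) % d ≡ (m * n) % d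
  [m*[n%d]]%d≡[m*n]%d m n = begin
    (m * (n % d)) % d            ≡⟨ %-distribˡ-* m (n % d) d ⟩
    (m % d * (n % d % d)) % d    ≡⟨ cong (λ k → (m % d * k) % d) (m%n%n≡m%n n d) ⟩
    (m % d * (n % d)) % d        ≡⟨ %-distribˡ-* m n d ⟨
    (m * n) % d                  ∎
    where open ≡-Reasoning

  [m%d*n]%d≡[m*n]%d : ∀ m n → (m % d * n) % d ≡ (m * n) % d
  [m%d*n]%d≡[m*n]%d m n = begin
    (m % d * n) % d              ≡⟨ %-distribˡ-* (m % d) n d ⟩
    (m % d % d * (n % d)) % d    ≡⟨ cong (λ k → (k * (n % d)) % d) (m%n%n≡m%n m d) ⟩
    (m % d * (n % d)) % d        ≡⟨ %-distribˡ-* m n d ⟨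
    (m * n) % d                  ∎
    where open ≡-Reasoning

  %-+-cong : ∀ {m m′ n n′} → m % d ≡ m′ % d → n % d ≡ n′ % d → (m + n) % d ≡ (m′ + n′) % d
  %-+-cong {m} {m′} {n} {n′} m≡m′ n≡n′ = begin
    (m + n) % d              ≡⟨ %-distribˡ-+ m n d ⟩
    (m % d + n % d) % d      ≡⟨ cong₂ (λ i j → (i + j) % d) m≡m′ n≡n′ ⟩
    (m′ % d + n′ % d) % d    ≡⟨ %-distribˡ-+ m′ n′ d ⟨
    (m′ + n′) % d            ∎
    where open ≡-Reasoning

∣∧<⇒≡0 : ∀ {m n} → m ∣ n → n < m → n ≡ 0
∣∧<⇒≡0 {n = zero}  _   _   = refl
∣∧<⇒≡0 {n = suc _} m∣n n<m = contradiction (∣⇒≤ m∣n) (<⇒≱ n<m)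

parity≡0ℙ⇒2∣ : ∀ n → parity n ≡ 0ℙ → 2 ∣ n
parity≡0ℙ⇒2∣ zero          _    = 2 ∣0
parity≡0ℙ⇒2∣ (suc zero)    ()
parity≡0ℙ⇒2∣ (suc (suc n)) even with divides k n≡2k ← parity≡0ℙ⇒2∣ n even =
  divides (suc k) (cong (2 +_) n≡2k)

module _ {p : ℕ} (p-prime : Prime p) where

  private instance
    p≢0 : NonZero p
    p≢0 = prime⇒nonZero p-prime

  prime≢2⇒parity[1+p]≡0ℙ : p ≢ 2 → parity (suc p) ≡ 0ℙ
  prime≢2⇒parity[1+p]≡0ℙ p≢2 with parity p in eq
  ... | 1ℙ = sym (⁻¹-selfInverse (trans (suc-homo-⁻¹ p) eq))
  ... | 0ℙ with prime⇒irreducible p-prime (parity≡0ℙ⇒2∣ p eq)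
  ...   | inj₂ 2≡p = contradiction (sym 2≡p) p≢2

  ∤⇒coprime : ∀ {s} → ¬ p ∣ s → Coprime p s
  ∤⇒coprime p∤s (d∣p , d∣s) with prime⇒irreducible p-prime d∣p
  ... | inj₁ d≡1  = d≡1
  ... | inj₂ refl = contradiction d∣s p∤s

  -- Bézout gives y with y s ≡ ±1, so t = r y or t = r y (p − 1) solves t s + r ≡ 0.
  linearCongruence-solvable : ∀ {s} r → ¬ p ∣ s → ∃[ t ] t < p × p ∣ t * s + r
  linearCongruence-solvable {s} r p∤s = reduce (solution (coprime-Bézout (∤⇒coprime p∤s)))
    where
    open ≡-Reasoning
    solution : Bézout.Identity 1 p s → ∃[ t ] p ∣ t * s + r
    solution (Bézout.+- x y 1+ys≡xp) = r * y , divides (r * x) (begin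
      r * y * s + r      ≡⟨ factor r y s ⟩
      r * (1 + y * s)    ≡⟨ cong (r *_) 1+ys≡xp ⟩
      r * (x * p)        ≡⟨ *-assoc r x p ⟨
      r * x * p          ∎)
      where
      factor : ∀ r y s → r * y * s + r ≡ r * (1 + y * s)
      factor = solve-∀
    solution (Bézout.-+ x y 1+xp≡ys) = r * y * m , divides (r + r * m * x) (begin
      r * y * m * s + r            ≡⟨ regroup r y m s ⟩
      r * m * (y * s) + r          ≡⟨ cong (λ k → r * m * k + r) 1+xp≡ys ⟨
      r * m * (1 + x * p) + r      ≡⟨ cong (λ q → r * m * (1 + x * q) + r) (suc-pred p) ⟨
      r * m * (1 + x * suc m) + r  ≡⟨ expand r m x ⟩
      (r + r * m * x) * suc m      ≡⟨ cong ((r + r * m * x) *_) (suc-pred p) ⟩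
      (r + r * m * x) * p          ∎)
      where
      m : ℕ
      m = pred p
      regroup : ∀ r y m s → r * y * m * s + r ≡ r * m * (y * s) + r
      regroup = solve-∀
      expand : ∀ r m x → r * m * (1 + x * suc m) + r ≡ (r + r * m * x) * suc m
      expand = solve-∀
    reduce : ∃[ t ] p ∣ t * s + r → ∃[ t ] t < p × p ∣ t * s + r
    reduce (t , p∣ts+r) = t % p , m%n<n t p , m%n≡0⇒n∣m _ p (begin
      (t % p * s + r) % p   ≡⟨ %-+-cong {d = p} ([m%d*n]%d≡[m*n]%d t s) refl ⟩
      (t * s + r) % p       ≡⟨ n∣m⇒m%n≡0 _ p p∣ts+r ⟩
      0                     ∎)

  private
    [t+d]s+r≡ts+r+ds : ∀ t d s r → (t + d) * s + r ≡ (t * s + r) + d * s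
    [t+d]s+r≡ts+r+ds = solve-∀

    linearCongruence-unique-≤ : ∀ {s r t t′} → ¬ p ∣ s → t ≤ t′ → t′ < p →
      p ∣ t * s + r → p ∣ t′ * s + r → t ≡ t′
    linearCongruence-unique-≤ {s} {r} {t} p∤s t≤t′ t′<p p∣ts+r p∣t′s+r
      with d , refl ← m≤n⇒∃[o]m+o≡n t≤t′
      with euclidsLemma d s p-prime (∣m+n∣m⇒∣n (subst (p ∣_) ([t+d]s+r≡ts+r+ds t d s r) p∣t′s+r) p∣ts+r)
    ... | inj₂ p∣s = contradiction p∣s p∤s
    ... | inj₁ p∣d = begin
      t      ≡⟨ +-identityʳ t ⟨
      t + 0  ≡⟨ cong (t +_) (∣∧<⇒≡0 p∣d (≤-<-trans (m≤n+m d t) t′<p)) ⟨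
      t + d  ∎
      where open ≡-Reasoning

  linearCongruence-unique : ∀ {s r t t′} → ¬ p ∣ s → t < p → t′ < p →
    p ∣ t * s + r → p ∣ t′ * s + r → t ≡ t′
  linearCongruence-unique {t = t} {t′} p∤s t<p t′<p p∣ts+r p∣t′s+r with ≤-total t t′
  ... | inj₁ t≤t′ = linearCongruence-unique-≤ p∤s t≤t′ t′<p p∣ts+r p∣t′s+r
  ... | inj₂ t′≤t = sym (linearCongruence-unique-≤ p∤s t′≤t t<p p∣t′s+r p∣ts+r)

indicator : ∀ {a} {A : Set a} → Dec A → Parity
indicator (yes _) = 1ℙ
indicator (no _)  = 0ℙ

indicator-yes : ∀ {a} {A : Set a} → A → (A? : Dec A) → indicator A? ≡ 1ℙ
indicator-yes a (yes _) = refl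
indicator-yes a (no ¬a) = contradiction a ¬a

indicator-no : ∀ {a} {A : Set a} → ¬ A → (A? : Dec A) → indicator A? ≡ 0ℙ
indicator-no ¬a (yes a) = contradiction a ¬a
indicator-no ¬a (no _)  = refl

∑-indicator-unique : ∀ {m} {A : Fin (suc m) → Set} (A? : ∀ k → Dec (A k)) {k₀} →
  A k₀ → (∀ {k} → A k → k ≡ k₀) → ∑[ k < suc m ] indicator (A? k) ≡ 1ℙ
∑-indicator-unique {m} {A} A? {k₀} a₀ unique = begin
  ∑[ k < suc m ] f k                    ≡⟨ sum-remove {i = k₀} f ⟩
  f k₀ ℙ.+ ∑[ j < m ] f (punchIn k₀ j)  ≡⟨ cong₂ ℙ._+_ (indicator-yes a₀ (A? k₀)) (sum-cong-≗ {m} off-k₀) ⟩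
  1ℙ ℙ.+ ∑[ j < m ] 0ℙ                  ≡⟨ cong (1ℙ ℙ.+_) (sum-replicate-zero m) ⟩
  1ℙ                                    ∎
  where
  open ≡-Reasoning
  f : Fin (suc m) → Parity
  f k = indicator (A? k)
  off-k₀ : ∀ j → f (punchIn k₀ j) ≡ 0ℙ
  off-k₀ j = indicator-no (λ a → punchInᵢ≢i k₀ j (unique a)) (A? (punchIn k₀ j))

1ℙ≢0ℙ : 1ℙ ≢ 0ℙ
1ℙ≢0ℙ ()

∑-1ℙ : ∀ m → ∑[ k < m ] 1ℙ ≡ parity m
∑-1ℙ zero    = refl
∑-1ℙ (suc m) = trans (cong _⁻¹ (∑-1ℙ m)) (⁻¹-selfInverse (suc-homo-⁻¹ m))

∑ₛ : ∀ {n} → (Subset n → Parity) → Parity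
∑ₛ {zero}  f = f []
∑ₛ {suc n} f = ∑ₛ (λ I → f (outside ∷ I)) ℙ.+ ∑ₛ (λ I → f (inside ∷ I))

∑ₛ-cong : ∀ {n} {f g : Subset n → Parity} → (∀ I → f I ≡ g I) → ∑ₛ f ≡ ∑ₛ g
∑ₛ-cong {zero}  f≗g = f≗g []
∑ₛ-cong {suc n} f≗g =
  cong₂ ℙ._+_ (∑ₛ-cong (λ I → f≗g (outside ∷ I))) (∑ₛ-cong (λ I → f≗g (inside ∷ I)))

∑ₛ-∑-comm : ∀ {n m} (B : Fin m → Subset n → Parity) →
  ∑ₛ (λ I → ∑[ k < m ] B k I) ≡ ∑[ k < m ] ∑ₛ (B k)
∑ₛ-∑-comm {zero}  B = refl
∑ₛ-∑-comm {suc n} B = trans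
  (cong₂ ℙ._+_ (∑ₛ-∑-comm (λ k I → B k (outside ∷ I))) (∑ₛ-∑-comm (λ k I → B k (inside ∷ I))))
  (sym (∑-distrib-+ (λ k → ∑ₛ (λ I → B k (outside ∷ I))) (λ k → ∑ₛ (λ I → B k (inside ∷ I)))))

∑ₛ-toggle-invariant : ∀ {n} (i : Fin n) (f : Subset n → Parity) →
  (∀ I → f (I [ i ]%= not) ≡ f I) → ∑ₛ f ≡ 0ℙ
∑ₛ-toggle-invariant {suc n} zero f inv =
  trans (cong (∑ₛ f₀ ℙ.+_) (∑ₛ-cong (λ I → inv (outside ∷ I)))) (p+p≡0ℙ (∑ₛ f₀))
  where
  f₀ : Subset n → Parity
  f₀ I = f (outside ∷ I)
∑ₛ-toggle-invariant (suc i) f inv = cong₂ ℙ._+_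
  (∑ₛ-toggle-invariant i (λ I → f (outside ∷ I)) (λ I → inv (outside ∷ I)))
  (∑ₛ-toggle-invariant i (λ I → f (inside ∷ I)) (λ I → inv (inside ∷ I)))

∑ₛ-nonempty : ∀ {n} (f : Subset (suc n) → Parity) →
  f ⊥ ≡ 0ℙ → (∀ I → Nonempty I → f I ≡ 1ℙ) → ∑ₛ f ≡ 1ℙ
∑ₛ-nonempty {zero} f f⊥ f-nonempty =
  cong₂ ℙ._+_ f⊥ (f-nonempty (inside ∷ []) (zero , here))
∑ₛ-nonempty {suc n} f f⊥ f-nonempty = cong₂ ℙ._+_ outside-half inside-half
  where
  outside-half : ∑ₛ (λ I → f (outside ∷ I)) ≡ 1ℙ
  outside-half = ∑ₛ-nonempty (λ I → f (outside ∷ I)) f⊥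
    (λ { I (i , i∈I) → f-nonempty (outside ∷ I) (suc i , there i∈I) })
  inside-half : ∑ₛ (λ I → f (inside ∷ I)) ≡ 0ℙ
  inside-half = ∑ₛ-toggle-invariant zero (λ I → f (inside ∷ I))
    (λ I → trans (f-nonempty _ (zero , here)) (sym (f-nonempty (inside ∷ I) (zero , here))))

module _ (p : ℕ) .{{_ : NonZero p}} where

  toℕ-mod : ∀ m → toℕ (m mod p) ≡ m % p
  toℕ-mod m = toℕ-fromℕ< _

  toℕ-0F : toℕ (0F p) ≡ 0
  toℕ-0F = trans (toℕ-mod 0) (m<n⇒m%n≡m (>-nonZero⁻¹ p))

  ∣⇒≡0F : (a : F p) → p ∣ toℕ a → a ≡ 0F p
  ∣⇒≡0F a p∣a = toℕ-injective (trans (∣∧<⇒≡0 p∣a (toℕ<n a)) (sym toℕ-0F))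

  +F-identityˡ : ∀ a → _+F_ p (0F p) a ≡ a
  +F-identityˡ a = toℕ-injective (begin
    toℕ (_+F_ p (0F p) a)     ≡⟨ toℕ-mod _ ⟩
    (toℕ (0F p) + toℕ a) % p  ≡⟨ cong (λ k → (k + toℕ a) % p) toℕ-0F ⟩
    toℕ a % p                 ≡⟨ m<n⇒m%n≡m (toℕ<n a) ⟩
    toℕ a                     ∎)
    where open ≡-Reasoning

  dot : V p → V p → F p
  dot (a , b) (w₁ , w₂) = _+F_ p (_*F_ p a w₁) (_*F_ p b w₂)

  dotℕ : V p → V p → ℕ
  dotℕ (a , b) (w₁ , w₂) = toℕ a * toℕ w₁ + toℕ b * toℕ w₂

  toℕ-dot : ∀ ab w → toℕ (dot ab w) ≡ dotℕ ab w % p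
  toℕ-dot (a , b) (w₁ , w₂) = begin
    toℕ (dot (a , b) (w₁ , w₂))                         ≡⟨ toℕ-mod _ ⟩
    (toℕ (_*F_ p a w₁) + toℕ (_*F_ p b w₂)) % p        ≡⟨ cong₂ (λ i j → (i + j) % p) (toℕ-mod _) (toℕ-mod _) ⟩
    ((toℕ a * toℕ w₁) % p + (toℕ b * toℕ w₂) % p) % p  ≡⟨ %-distribˡ-+ (toℕ a * toℕ w₁) _ p ⟨
    dotℕ (a , b) (w₁ , w₂) % p                          ∎
    where open ≡-Reasoning

  onLine⇔∣ : ∀ ab w → OnLine p ab w ⇔ p ∣ dotℕ ab w
  onLine⇔∣ ab w = mk⇔
    (λ on → m%n≡0⇒n∣m (dotℕ ab w) p (trans (sym (toℕ-dot ab w)) (trans (cong toℕ on) toℕ-0F)))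
    (λ p∣ → toℕ-injective (trans (toℕ-dot ab w) (trans (n∣m⇒m%n≡0 (dotℕ ab w) p p∣) (sym toℕ-0F))))

  dot-+V : ∀ ab u v → dot ab (_+V_ p u v) ≡ _+F_ p (dot ab u) (dot ab v)
  dot-+V (a , b) (u₁ , u₂) (v₁ , v₂) = toℕ-injective (begin
    toℕ (dot (a , b) (_+V_ p (u₁ , u₂) (v₁ , v₂)))     ≡⟨ toℕ-dot (a , b) _ ⟩
    (A * toℕ (_+F_ p u₁ v₁) + B * toℕ (_+F_ p u₂ v₂)) % p
      ≡⟨ cong₂ (λ i j → (A * i + B * j) % p) (toℕ-mod _) (toℕ-mod _) ⟩
    (A * ((U₁ + V₁) % p) + B * ((U₂ + V₂) % p)) % p
      ≡⟨ %-+-cong ([m*[n%d]]%d≡[m*n]%d A (U₁ + V₁)) ([m*[n%d]]%d≡[m*n]%d B (U₂ + V₂)) ⟩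
    (A * (U₁ + V₁) + B * (U₂ + V₂)) % p               ≡⟨ cong (_% p) (bilinear A B U₁ U₂ V₁ V₂) ⟩
    (dotℕ (a , b) (u₁ , u₂) + dotℕ (a , b) (v₁ , v₂)) % p
      ≡⟨ %-distribˡ-+ (dotℕ (a , b) (u₁ , u₂)) _ p ⟩
    (dotℕ (a , b) (u₁ , u₂) % p + dotℕ (a , b) (v₁ , v₂) % p) % p
      ≡⟨ cong₂ (λ i j → (i + j) % p) (toℕ-dot (a , b) (u₁ , u₂)) (toℕ-dot (a , b) (v₁ , v₂)) ⟨
    (toℕ (dot (a , b) (u₁ , u₂)) + toℕ (dot (a , b) (v₁ , v₂))) % p
      ≡⟨ toℕ-mod _ ⟨
    toℕ (_+F_ p (dot (a , b) (u₁ , u₂)) (dot (a , b) (v₁ , v₂)))  ∎)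
    where
    open ≡-Reasoning
    A B U₁ U₂ V₁ V₂ : ℕ
    A = toℕ a ; B = toℕ b ; U₁ = toℕ u₁ ; U₂ = toℕ u₂ ; V₁ = toℕ v₁ ; V₂ = toℕ v₂
    bilinear : ∀ A B U₁ U₂ V₁ V₂ → A * (U₁ + V₁) + B * (U₂ + V₂) ≡ (A * U₁ + B * U₂) + (A * V₁ + B * V₂)
    bilinear = solve-∀

  onLine-0V : ∀ ab → OnLine p ab (0V p)
  onLine-0V (a , b) = Equivalence.from (onLine⇔∣ (a , b) (0V p)) (subst (p ∣_) (sym dotℕ≡0) (p ∣0))
    where
    dotℕ≡0 : dotℕ (a , b) (0V p) ≡ 0
    dotℕ≡0 = trans (cong (λ z → toℕ a * z + toℕ b * z) toℕ-0F) (cong₂ _+_ (*-zeroʳ (toℕ a)) (*-zeroʳ (toℕ b)))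

  onLine-+V : ∀ ab u v → OnLine p ab u → dot ab (_+V_ p u v) ≡ dot ab v
  onLine-+V ab u v on = begin
    dot ab (_+V_ p u v)           ≡⟨ dot-+V ab u v ⟩
    _+F_ p (dot ab u) (dot ab v)  ≡⟨ cong (λ c → _+F_ p c (dot ab v)) on ⟩
    _+F_ p (0F p) (dot ab v)      ≡⟨ +F-identityˡ (dot ab v) ⟩
    dot ab v                      ∎
    where open ≡-Reasoning

  dot-subsetSum-toggle : ∀ {n} ab (x : Fin n → V p) i → OnLine p ab (x i) →
    ∀ I → dot ab (subsetSum p x (I [ i ]%= not)) ≡ dot ab (subsetSum p x I)
  dot-subsetSum-toggle ab x zero    on (outside ∷ I) = onLine-+V ab (x zero) _ on
  dot-subsetSum-toggle ab x zero    on (inside ∷ I)  = sym (onLine-+V ab (x zero) _ on)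
  dot-subsetSum-toggle ab x (suc i) on (outside ∷ I) = dot-subsetSum-toggle ab (λ j → x (suc j)) i on I
  dot-subsetSum-toggle {suc n} ab x (suc i) on (inside ∷ I) = begin
    dot ab (_+V_ p (x zero) (subsetSum p x′ (I [ i ]%= not)))          ≡⟨ dot-+V ab (x zero) _ ⟩
    _+F_ p (dot ab (x zero)) (dot ab (subsetSum p x′ (I [ i ]%= not)))
      ≡⟨ cong (_+F_ p (dot ab (x zero))) (dot-subsetSum-toggle ab x′ i on I) ⟩
    _+F_ p (dot ab (x zero)) (dot ab (subsetSum p x′ I))               ≡⟨ dot-+V ab (x zero) _ ⟨
    dot ab (_+V_ p (x zero) (subsetSum p x′ I))                        ∎
    where
    open ≡-Reasoning
    x′ : Fin n → V p
    x′ j = x (suc j)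

  subsetSum-⊥ : ∀ {n} (x : Fin n → V p) → subsetSum p x ⊥ ≡ 0V p
  subsetSum-⊥ {zero}  x = refl
  subsetSum-⊥ {suc n} x = subsetSum-⊥ (λ j → x (suc j))

  ZeroSumFree : ∀ {n} → (Fin n → V p) → Set
  ZeroSumFree x = ∀ I → Nonempty I → subsetSum p x I ≢ 0V p

  module _ (p-prime : Prime p) where

    private
      1<p : 1 < p
      1<p = nonTrivial⇒n>1 p {{prime⇒nonTrivial p-prime}}

    1F : F p
    1F = fromℕ< 1<p

    1F≢0F : 1F ≢ 0F p
    1F≢0F 1F≡0F with () ← trans (sym (toℕ-fromℕ< 1<p)) (trans (cong toℕ 1F≡0F) toℕ-0F)

    -- normal zero gives the line w₁ = 0 and normal (suc t) the line w₂ = −t w₁.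
    normal : Fin (suc p) → V p
    normal zero    = 1F , 0F p
    normal (suc t) = t , 1F

    normal≢0V : ∀ k → normal k ≢ 0V p
    normal≢0V zero    n≡0 = 1F≢0F (cong proj₁ n≡0)
    normal≢0V (suc t) n≡0 = 1F≢0F (cong proj₂ n≡0)

    onLine-zero⇔ : ∀ w₁ w₂ → OnLine p (normal zero) (w₁ , w₂) ⇔ p ∣ toℕ w₁
    onLine-zero⇔ w₁ w₂ =
      subst (λ m → OnLine p (normal zero) (w₁ , w₂) ⇔ p ∣ m) dotℕ≡w₁ (onLine⇔∣ (normal zero) (w₁ , w₂))
      where
      dotℕ≡w₁ : dotℕ (normal zero) (w₁ , w₂) ≡ toℕ w₁
      dotℕ≡w₁ = trans (cong₂ (λ i j → i * toℕ w₁ + j * toℕ w₂) (toℕ-fromℕ< 1<p) toℕ-0F)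
                      (trans (+-identityʳ (1 * toℕ w₁)) (*-identityˡ (toℕ w₁)))

    onLine-suc⇔ : ∀ t w₁ w₂ → OnLine p (normal (suc t)) (w₁ , w₂) ⇔ p ∣ toℕ t * toℕ w₁ + toℕ w₂
    onLine-suc⇔ t w₁ w₂ =
      subst (λ m → OnLine p (normal (suc t)) (w₁ , w₂) ⇔ p ∣ m) dotℕ≡tw₁+w₂ (onLine⇔∣ (normal (suc t)) (w₁ , w₂))
      where
      dotℕ≡tw₁+w₂ : dotℕ (normal (suc t)) (w₁ , w₂) ≡ toℕ t * toℕ w₁ + toℕ w₂
      dotℕ≡tw₁+w₂ = cong (toℕ t * toℕ w₁ +_) (trans (cong (_* toℕ w₂) (toℕ-fromℕ< 1<p)) (*-identityˡ (toℕ w₂)))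

    onSomeLine : ∀ w → ∃[ k ] OnLine p (normal k) w
    onSomeLine (w₁ , w₂) with p ∣? toℕ w₁
    ... | yes p∣w₁ = zero , Equivalence.from (onLine-zero⇔ w₁ w₂) p∣w₁
    ... | no p∤w₁ with t , t<p , p∣tw₁+w₂ ← linearCongruence-solvable p-prime (toℕ w₂) p∤w₁ =
      suc (fromℕ< t<p) , Equivalence.from (onLine-suc⇔ (fromℕ< t<p) w₁ w₂)
        (subst (λ u → p ∣ u * toℕ w₁ + toℕ w₂) (sym (toℕ-fromℕ< t<p)) p∣tw₁+w₂)

    private
      ∣∧onLine-suc⇒≡0V : ∀ t {w₁ w₂} → p ∣ toℕ w₁ → OnLine p (normal (suc t)) (w₁ , w₂) →
        (w₁ , w₂) ≡ 0V p
      ∣∧onLine-suc⇒≡0V t {w₁} {w₂} p∣w₁ on = cong₂ _,_ (∣⇒≡0F w₁ p∣w₁) (∣⇒≡0F w₂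
        (∣m+n∣m⇒∣n (Equivalence.to (onLine-suc⇔ t w₁ w₂) on) (∣n⇒∣m*n (toℕ t) p∣w₁)))

    onLine-unique : ∀ {w k k′} → w ≢ 0V p → OnLine p (normal k) w → OnLine p (normal k′) w → k ≡ k′
    onLine-unique {w₁ , w₂} {zero}  {zero}   _   _  _   = refl
    onLine-unique {w₁ , w₂} {zero}  {suc t′} w≢0 on on′ =
      contradiction (∣∧onLine-suc⇒≡0V t′ (Equivalence.to (onLine-zero⇔ w₁ w₂) on) on′) w≢0
    onLine-unique {w₁ , w₂} {suc t} {zero}   w≢0 on on′ =
      contradiction (∣∧onLine-suc⇒≡0V t (Equivalence.to (onLine-zero⇔ w₁ w₂) on′) on) w≢0
    onLine-unique {w₁ , w₂} {suc t} {suc t′} w≢0 on on′ with p ∣? toℕ w₁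
    ... | yes p∣w₁ = contradiction (∣∧onLine-suc⇒≡0V t p∣w₁ on) w≢0
    ... | no p∤w₁  = cong suc (toℕ-injective (linearCongruence-unique p-prime p∤w₁ (toℕ<n t) (toℕ<n t′)
      (Equivalence.to (onLine-suc⇔ t w₁ w₂) on) (Equivalence.to (onLine-suc⇔ t′ w₁ w₂) on′)))

    spansAllDirections⇒¬zeroSumFree : p ≢ 2 → ∀ {n} (x : Fin n → V p) →
      SpansAllDirections p x → ¬ ZeroSumFree x
    spansAllDirections⇒¬zeroSumFree _ {zero} x spans _
      with () ← proj₁ (spans (normal zero) (normal≢0V zero))
    spansAllDirections⇒¬zeroSumFree p≢2 {suc n} x spans zeroSumFree = 1ℙ≢0ℙ (begin
      1ℙ                            ≡⟨ ∑ₛ-nonempty linesThrough linesThrough-⊥ linesThrough-nonempty ⟨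
      ∑ₛ linesThrough               ≡⟨ ∑ₛ-∑-comm onLine ⟩
      ∑[ k < suc p ] ∑ₛ (onLine k)  ≡⟨ sum-cong-≗ {suc p} (λ k → ∑ₛ-toggle-invariant (pointOn k) (onLine k) (onLine-toggle k)) ⟩
      ∑[ k < suc p ] 0ℙ             ≡⟨ sum-replicate-zero (suc p) ⟩
      0ℙ                            ∎)
      where
      open ≡-Reasoning
      onLine? : ∀ k I → Dec (OnLine p (normal k) (subsetSum p x I))
      onLine? k I = dot (normal k) (subsetSum p x I) ≟ 0F p
      onLine : Fin (suc p) → Subset (suc n) → Parity
      onLine k I = indicator (onLine? k I)
      linesThrough : Subset (suc n) → Parity
      linesThrough I = ∑[ k < suc p ] onLine k I
      pointOn : Fin (suc p) → Fin (suc n)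
      pointOn k = proj₁ (spans (normal k) (normal≢0V k))
      onLine-toggle : ∀ k I → onLine k (I [ pointOn k ]%= not) ≡ onLine k I
      onLine-toggle k I = cong (λ v → indicator (v ≟ 0F p))
        (dot-subsetSum-toggle (normal k) x (pointOn k) (proj₂ (spans (normal k) (normal≢0V k))) I)
      linesThrough-⊥ : linesThrough ⊥ ≡ 0ℙ
      linesThrough-⊥ = begin
        linesThrough ⊥     ≡⟨ sum-cong-≗ {suc p} (λ k → indicator-yes (onLine-⊥ k) (onLine? k ⊥)) ⟩
        ∑[ k < suc p ] 1ℙ  ≡⟨ ∑-1ℙ (suc p) ⟩
        parity (suc p)     ≡⟨ prime≢2⇒parity[1+p]≡0ℙ p-prime p≢2 ⟩
        0ℙ                 ∎
        where
        onLine-⊥ : ∀ k → OnLine p (normal k) (subsetSum p x ⊥)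
        onLine-⊥ k = subst (OnLine p (normal k)) (sym (subsetSum-⊥ x)) (onLine-0V (normal k))
      linesThrough-nonempty : ∀ I → Nonempty I → linesThrough I ≡ 1ℙ
      linesThrough-nonempty I I≢∅ = ∑-indicator-unique (λ k → onLine? k I) {proj₁ (onSomeLine S)} (proj₂ (onSomeLine S))
        (λ on → onLine-unique (zeroSumFree I I≢∅) on (proj₂ (onSomeLine S)))
        where
        S : V p
        S = subsetSum p x I

theorem1 : (p : ℕ) → .{{_ : NonZero p}} → Prime p → ¬ p ≡ 2 →
    (n : ℕ) → (x : Fin n → V p) → Injective _≡_ _≡_ x →
    ((i : Fin n) → ¬ x i ≡ 0V p) →
    SpansAllDirections p x →
    Σ (Subset n) λ I → Nonempty I × subsetSum p x I ≡ 0V p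
theorem1 p p-prime p≢2 n x _ _ spans
  with anySubset? (λ I → nonempty? I ×-dec ≡-dec _≟_ _≟_ (subsetSum p x I) (0V p))
... | yes zeroSum   = zeroSum
... | no ¬zeroSum   = contradiction (λ I I≢∅ sum≡0 → ¬zeroSum (I , I≢∅ , sum≡0))
                        (spansAllDirections⇒¬zeroSumFree p p-prime p≢2 x spans)
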